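{- Let \[ A(p,q,v)=\sum_{D}p^{\mathrm{nbp}(D)}q^{\mathrm{sump}(D)}v^{\mathrm{sumv}(D)}, \] the sum running over all non-empty Dyck paths $D$. Equivalently, $A(p,q,v)=\sum_P p^{\mathrm{row}(P)}q^{\mathrm{area}(P)-\mathrm{row}(P)}v^{\mathrm{point}(P)}$ summed over Stanley polyominoes $P$ with at least two columns. Then \[ A(p,q,v)=-1+\cfrac{v}{1+v-pqv-\cfrac{v}{1+v-pq^{2}v^2-\cfrac{v}{1+v-pq^{3}v^3-\cfrac{v}{1+v-\cdots}}}}, \] where the $j$-th partial denominator is $1+v-pq^jv^j$.
   Context: Dyck paths are lattice paths from $(0,0)$ to $(2n,0)$ with steps $u=(1,1)$, $d=(1,-1)$ never going below the $x$-axis. A peak is an occurrence of $ud$ and a valley an occurrence of $du$; its height is the ordinate of the common point of the two steps. $\mathrm{nbp}(D)$ is the number of peaks, $\mathrm{sump}(D)$ the sum of peak heights, $\mathrm{sumv}(D)$ the sum of valley heights. A Stanley polyomino (up to translation) is a set of unit cells $[i,i+1]\times[j,j+1]$ forming rows $0,\dots,k-1$ (bottom to top), row $j$ consisting of the cells with $s_j\le i\le e_j$, such that $s_{j-1}<s_j\le e_{j-1}<e_j$; $\mathrm{row}(P)=k$, $\mathrm{area}(P)$ is the number of cells, the number of columns is $e_{k-1}-s_0+1$, and $\mathrm{point}(P)$ is the number of lattice points belonging to exactly four cells of $P$. -}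

module Defs where

open import Data.Bool using (Bool; true; false; _∧_; if_then_else_)
open import Data.Nat as ℕ using (ℕ; zero; suc; _∸_; _≤ᵇ_; _≡ᵇ_)
open import Data.Integer as ℤ using (ℤ; +_; 0ℤ; 1ℤ)
open import Data.List using (List; []; _∷_; _++_; map; filter; length; concatMap; sum; foldr)
open import Data.Product using (_×_; _,_; proj₁; proj₂)
open import Relation.Nullary.Decidable using (yes; no)
open import Relation.Binary.PropositionalEquality using (_≡_)

data Step : Set where
  u d : Step

words : ℕ → List (List Step)
words zero    = [] ∷ []
words (suc m) = concatMap (λ w → (u ∷ w) ∷ (d ∷ w) ∷ []) (words m)

valid : ℕ → List Step → Bool
valid zero    []      = true
valid (suc h) []      = false
valid h       (u ∷ w) = valid (suc h) w
valid zero    (d ∷ w) = false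
valid (suc h) (d ∷ w) = valid h w

dyckPaths : ℕ → List (List Step)
dyckPaths n = filter (λ w → valid 0 w Data.Bool.≟ true) (words (n ℕ.+ n))
  where import Data.Bool

nbp : List Step → ℕ
nbp []            = 0
nbp (u ∷ d ∷ w)   = suc (nbp (d ∷ w))
nbp (u ∷ u ∷ w)   = nbp (u ∷ w)
nbp (u ∷ [])      = 0
nbp (d ∷ w)       = nbp w

sumpFrom : ℕ → List Step → ℕ
sumpFrom h []          = 0
sumpFrom h (u ∷ d ∷ w) = suc h ℕ.+ sumpFrom (suc h) (d ∷ w)
sumpFrom h (u ∷ u ∷ w) = sumpFrom (suc h) (u ∷ w)
sumpFrom h (u ∷ [])    = 0
sumpFrom h (d ∷ w)     = sumpFrom (h ∸ 1) w

sump : List Step → ℕ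
sump = sumpFrom 0

sumvFrom : ℕ → List Step → ℕ
sumvFrom h []          = 0
sumvFrom h (d ∷ u ∷ w) = (h ∸ 1) ℕ.+ sumvFrom (h ∸ 1) (u ∷ w)
sumvFrom h (d ∷ d ∷ w) = sumvFrom (h ∸ 1) (d ∷ w)
sumvFrom h (d ∷ [])    = 0
sumvFrom h (u ∷ w)     = sumvFrom (suc h) w

sumv : List Step → ℕ
sumv = sumvFrom 0

hasStats : ℕ → ℕ → ℕ → List Step → Bool
hasStats a b c D = (nbp D ≡ᵇ a) ∧ ((sump D ≡ᵇ b) ∧ (sumv D ≡ᵇ c))

countBool : {A : Set} → (A → Bool) → List A → ℕ
countBool P []       = 0
countBool P (x ∷ xs) = (if P x then 1 else 0) ℕ.+ countBool P xs

countAt : ℕ → ℕ → ℕ → ℕ → ℕ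
countAt n a b c = countBool (hasStats a b c) (dyckPaths n)

countUpTo : ℕ → ℕ → ℕ → ℕ → ℕ
countUpTo zero    a b c = 0
countUpTo (suc m) a b c = countAt (suc m) a b c ℕ.+ countUpTo m a b c

-- coefficient of p^a q^b v^c in A.  Only semilengths 1..b can contribute
-- (this is asserted as part of theorem3p1, so the truncation is justified there).
coeffA : ℕ → ℕ → ℕ → ℤ
coeffA a b c = + countUpTo b a b c

Series : Set
Series = ℕ → ℕ → ℕ → ℤ

onePlusA : Series
onePlusA zero zero zero = 1ℤ ℤ.+ coeffA 0 0 0
onePlusA a b c          = coeffA a b c

-- polynomials in ℤ[p,q,v] as lists of terms  k · p^i q^j v^l
Poly : Set
Poly = List (ℤ × ℕ × ℕ × ℕ)

mono : ℤ → ℕ → ℕ → ℕ → Poly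
mono k i j l = (k , i , j , l) ∷ []

_⊕_ : Poly → Poly → Poly
P ⊕ Q = P ++ Q

⊖_ : Poly → Poly
⊖ P = map (λ { (k , i , j , l) → (ℤ.- k , i , j , l) }) P

_⊗_ : Poly → Poly → Poly
P ⊗ Q = concatMap (λ { (k , i , j , l) →
          map (λ { (k' , i' , j' , l') → (k ℤ.* k' , i ℕ.+ i' , j ℕ.+ j' , l ℕ.+ l') }) Q }) P

polyCoeff : Poly → ℕ → ℕ → ℕ → ℤ
polyCoeff []                    a b c = 0ℤ
polyCoeff ((k , i , j , l) ∷ P) a b c =
  (if (i ≡ᵇ a) ∧ ((j ≡ᵇ b) ∧ (l ≡ᵇ c)) then k else 0ℤ) ℤ.+ polyCoeff P a b c

mulCoeff : Series → Poly → ℕ → ℕ → ℕ → ℤ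
mulCoeff S []                    a b c = 0ℤ
mulCoeff S ((k , i , j , l) ∷ P) a b c =
  (if (i ≤ᵇ a) ∧ ((j ≤ᵇ b) ∧ (l ≤ᵇ c)) then k ℤ.* S (a ∸ i) (b ∸ j) (c ∸ l) else 0ℤ)
  ℤ.+ mulCoeff S P a b c

-- The continued fraction
--   F_j = v / (1 + v - p q^j v^j - F_{j+1}),   A = -1 + F_1.
-- `cf j k` = (P , Q) with P/Q the value of F_j when the fraction is cut
-- after k further levels, the tail F_{j+k} being replaced by 1
-- (the value of every F_j at p = 0, i.e. the fixed point of F ↦ v/(1+v-F)
-- selected by A(0,q,v) = 0).

pq^v^ : ℕ → Poly
pq^v^ j = mono 1ℤ 1 j j

cf : ℕ → ℕ → Poly × Poly
cf j zero    = mono 1ℤ 0 0 0 , mono 1ℤ 0 0 0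
cf j (suc k) with cf (suc j) k
... | (P , Q) = (mono 1ℤ 0 0 1 ⊗ Q)
              , (((mono 1ℤ 0 0 0 ⊕ mono 1ℤ 0 0 1) ⊕ (⊖ pq^v^ j)) ⊗ Q) ⊕ (⊖ P)

-- N-th convergent of -1 + F_1 is  -1 + numCF N / denCF N
numCF : ℕ → Poly
numCF N = proj₁ (cf 1 N)

denCF : ℕ → Poly
denCF N = proj₂ (cf 1 N)

{-# OPTIONS --safe #-}

-- Let U h and D h be the generating functions of the paths from height h down to the axis whose
-- first step is, respectively is not, an up step. Splitting off the first step gives
--   U h = U (h+1) + p q^(h+1) D (h+1)   and   D (h+1) = v^h U h + D h,
-- where D 0 = 1 and D 1 = 1 + A, because a valley at height 0 has weight v^0 = 1. Eliminating U
-- gives the three-term recurrence D (h+2) = (1 + v - p q^(h+1) v^(h+1)) D (h+1) - v D h.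
-- The numerators and denominators of the continued fraction obey the same recurrence, so for the
-- N-th convergent P/Q the series D 1 Q - P telescopes to D (N+1) - D N = v^N U N. Every path
-- counted by U N has its first peak above height N, so this difference has no terms of q-degree
-- at most N.
-- A path from height h whose peak heights sum to b has at most h + 2b steps, since every run of
-- up steps ends in a peak at least as high as the run is long. Hence every coefficient is a
-- finite count, and a Dyck path of semilength n has sump at least n.

module Submission where

open import Defs
open import Data.Bool using (Bool; true; false; not; _∧_; if_then_else_; T; _≟_)
open import Data.Bool.Properties using (not-involutive; not-injective; if-eta; if-float; T-∧)
open import Data.Bool.Solver using (module ∨-∧-Solver)
open import Data.Nat using (ℕ; zero; suc; _+_; _∸_; _≤ᵇ_; _≡ᵇ_; _≤_; _<_; z≤n; s≤s)
open import Data.Nat.Properties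
  using (≤-refl; ≤-trans; ≤-reflexive; ≤-pred; n≤1+n; <⇒≱; m≤n⇒m<n∨m≡n; m≤n⇒m≤1+n; m≤m+n; m≤n+m; ≤ᵇ⇒≤;
         +-suc; +-comm; +-assoc; +-identityʳ; +-cancelʳ-≤; +-mono-<; m+[n∸m]≡n; ∸-+-assoc)
open import Data.Nat.Tactic.RingSolver using (solve-∀)
open import Data.Integer as ℤ using (ℤ; +_; 0ℤ; 1ℤ)
open import Data.Integer.Properties
  using (pos-+; neg-distrib-+; neg-distribˡ-*; neg-distribʳ-*; *-distribˡ-+; *-zeroʳ; *-identityˡ; *-identityʳ;
         +-identityˡ; i≡j⇒i-j≡0; i-j≡0⇒i≡j)
import Data.Integer.Properties as ℤP
import Data.Integer.Tactic.RingSolver as ℤ-Solver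
open import Data.List using (List; []; _∷_; _++_; map; filter; concatMap)
open import Data.Product using (_×_; _,_; proj₁; proj₂)
open import Data.Empty using (⊥-elim)
open import Data.Sum using (inj₁; inj₂)
open import Function.Bundles using (Equivalence)
open import Relation.Binary.PropositionalEquality using (_≡_; refl; sym; trans; cong; cong₂; subst; module ≡-Reasoning)

≤ᵇ-suc : ∀ m n → (suc m ≤ᵇ suc n) ≡ (m ≤ᵇ n)
≤ᵇ-suc zero    n = refl
≤ᵇ-suc (suc m) n = refl

+-≡ᵇ-split : ∀ m n o → (m + n ≡ᵇ o) ≡ (m ≤ᵇ o) ∧ (n ≡ᵇ o ∸ m)
+-≡ᵇ-split zero    n o       = refl
+-≡ᵇ-split (suc m) n zero    = refl
+-≡ᵇ-split (suc m) n (suc o) rewrite ≤ᵇ-suc m o = +-≡ᵇ-split m n o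

+-≤ᵇ-split : ∀ m n o → (m + n ≤ᵇ o) ≡ (m ≤ᵇ o) ∧ (n ≤ᵇ o ∸ m)
+-≤ᵇ-split zero    n o       = refl
+-≤ᵇ-split (suc m) n zero    = refl
+-≤ᵇ-split (suc m) n (suc o) rewrite ≤ᵇ-suc (m + n) o | ≤ᵇ-suc m o = +-≤ᵇ-split m n o

∧-interchange₃ : ∀ x₁ y₁ x₂ y₂ x₃ y₃ →
  (x₁ ∧ y₁) ∧ ((x₂ ∧ y₂) ∧ (x₃ ∧ y₃)) ≡ (x₁ ∧ (x₂ ∧ x₃)) ∧ (y₁ ∧ (y₂ ∧ y₃))
∧-interchange₃ = solve 6 (λ x₁ y₁ x₂ y₂ x₃ y₃ →
  (x₁ :* y₁) :* ((x₂ :* y₂) :* (x₃ :* y₃)) := (x₁ :* (x₂ :* x₃)) :* (y₁ :* (y₂ :* y₃))) refl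
  where open ∨-∧-Solver

if-then-cong : ∀ {A : Set} C {x y z : A} → (T C → x ≡ y) → (if C then x else z) ≡ (if C then y else z)
if-then-cong false _   = refl
if-then-cong true  x≡y = x≡y _

if-collapse : ∀ {A : Set} C {x z : A} → (T C → x ≡ z) → (if C then x else z) ≡ z
if-collapse C x≡z = trans (if-then-cong C x≡z) (if-eta C)

even : ℕ → Bool
even zero    = true
even (suc n) = not (even n)

even-double : ∀ k → even (k + k) ≡ true
even-double zero    = refl
even-double (suc k) rewrite +-suc k k | not-involutive (even (k + k)) = even-double k

sumBelow : ℕ → (ℕ → ℕ) → ℕ
sumBelow zero    f = 0
sumBelow (suc K) f = sumBelow K f + f K

syntax sumBelow K (λ m → e) = ∑[ m < K ] e

∑-cong : ∀ K {f g : ℕ → ℕ} → (∀ m → f m ≡ g m) → ∑[ m < K ] f m ≡ ∑[ m < K ] g m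
∑-cong zero    f≡g = refl
∑-cong (suc K) f≡g = cong₂ _+_ (∑-cong K f≡g) (f≡g K)

∑-zero : ∀ K {f : ℕ → ℕ} → (∀ m → f m ≡ 0) → ∑[ m < K ] f m ≡ 0
∑-zero zero    f≡0 = refl
∑-zero (suc K) f≡0 = cong₂ _+_ (∑-zero K f≡0) (f≡0 K)

∑-+ : ∀ K (f g : ℕ → ℕ) → ∑[ m < K ] (f m + g m) ≡ ∑[ m < K ] f m + ∑[ m < K ] g m
∑-+ zero    f g = refl
∑-+ (suc K) f g rewrite ∑-+ K f g = interchange (∑[ m < K ] f m) (∑[ m < K ] g m) (f K) (g K)
  where
  interchange : ∀ w x y z → (w + x) + (y + z) ≡ (w + y) + (x + z)
  interchange = solve-∀

∑-if : ∀ K C (f : ℕ → ℕ) → ∑[ m < K ] (if C then f m else 0) ≡ (if C then ∑[ m < K ] f m else 0)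
∑-if K true  f = refl
∑-if K false f = ∑-zero K (λ _ → refl)

∑-head : ∀ K (f : ℕ → ℕ) → ∑[ m < suc K ] f m ≡ f 0 + ∑[ m < K ] f (suc m)
∑-head zero    f = +-comm 0 (f 0)
∑-head (suc K) f rewrite ∑-head K f = +-assoc (f 0) _ _

∑-truncate : ∀ {M} K (f : ℕ → ℕ) → (∀ m → M ≤ m → f m ≡ 0) → M ≤ K → ∑[ m < K ] f m ≡ ∑[ m < M ] f m
∑-truncate zero    f vanish z≤n = refl
∑-truncate (suc K) f vanish M≤1+K with m≤n⇒m<n∨m≡n M≤1+K
... | inj₂ refl  = refl
... | inj₁ M<1+K =
  trans (cong₂ _+_ (∑-truncate K f vanish (≤-pred M<1+K)) (vanish K (≤-pred M<1+K))) (+-identityʳ _)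

∑-stable : ∀ {M} K K′ (f : ℕ → ℕ) → (∀ m → M ≤ m → f m ≡ 0) → M ≤ K → M ≤ K′ →
           ∑[ m < K ] f m ≡ ∑[ m < K′ ] f m
∑-stable K K′ f vanish M≤K M≤K′ = trans (∑-truncate K f vanish M≤K) (sym (∑-truncate K′ f vanish M≤K′))

∑-even : ∀ n (f : ℕ → ℕ) → (∀ k → f (suc (k + k)) ≡ 0) → ∑[ m < suc (n + n) ] f m ≡ ∑[ k < suc n ] f (k + k)
∑-even zero    f odd = refl
∑-even (suc n) f odd rewrite +-suc n n =
  cong (_+ f (suc (suc (n + n)))) (trans (cong₂ _+_ (∑-even n f odd) (odd n)) (+-identityʳ _))

-- Counting path tails

countBool-cong : ∀ {A : Set} {P Q : A → Bool} → (∀ x → P x ≡ Q x) → ∀ xs → countBool P xs ≡ countBool Q xs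
countBool-cong P≡Q []       = refl
countBool-cong P≡Q (x ∷ xs) = cong₂ _+_ (cong (λ b → if b then 1 else 0) (P≡Q x)) (countBool-cong P≡Q xs)

countBool-false : ∀ {A : Set} (xs : List A) → countBool (λ _ → false) xs ≡ 0
countBool-false []       = refl
countBool-false (x ∷ xs) = countBool-false xs

countBool-guard : ∀ {A : Set} C (P : A → Bool) xs → countBool (λ x → C ∧ P x) xs ≡ (if C then countBool P xs else 0)
countBool-guard true  P xs = refl
countBool-guard false P xs = countBool-false xs

countBool-filter : ∀ {A : Set} (Q P : A → Bool) xs →
  countBool P (filter (λ x → Q x ≟ true) xs) ≡ countBool (λ x → Q x ∧ P x) xs
countBool-filter Q P []       = refl
countBool-filter Q P (x ∷ xs) with Q x
... | true  = cong₂ _+_ refl (countBool-filter Q P xs)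
... | false = countBool-filter Q P xs

countBool-words-suc : ∀ (P : List Step → Bool) m →
  countBool P (words (suc m)) ≡ countBool (λ w → P (u ∷ w)) (words m) + countBool (λ w → P (d ∷ w)) (words m)
countBool-words-suc P m = go (words m)
  where
  go : ∀ ws → countBool P (concatMap (λ w → (u ∷ w) ∷ (d ∷ w) ∷ []) ws)
            ≡ countBool (λ w → P (u ∷ w)) ws + countBool (λ w → P (d ∷ w)) ws
  go []       = refl
  go (w ∷ ws) rewrite go ws = shuffle (if P (u ∷ w) then 1 else 0) (if P (d ∷ w) then 1 else 0) _ _
    where
    shuffle : ∀ w x y z → w + (x + (y + z)) ≡ (w + y) + (x + z)
    shuffle = solve-∀

isPath : ℕ → ℕ → ℕ → ℕ → List Step → Bool
isPath h a b c w = valid h w ∧ ((nbp w ≡ᵇ a) ∧ ((sumpFrom h w ≡ᵇ b) ∧ (sumvFrom h w ≡ᵇ c)))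

valid-u : ∀ h w → valid h (u ∷ w) ≡ valid (suc h) w
valid-u zero    w = refl
valid-u (suc h) w = refl

isPath-uu : ∀ h a b c w → isPath h a b c (u ∷ u ∷ w) ≡ isPath (suc h) a b c (u ∷ w)
isPath-uu zero    a b c w = refl
isPath-uu (suc h) a b c w = refl

-- The support condition of the monomial p q^(h+1) in mulCoeff, so that a peak lifts verbatim to series.
peakGuard : ℕ → ℕ → ℕ → ℕ → Bool
peakGuard h a b c = (1 ≤ᵇ a) ∧ ((suc h ≤ᵇ b) ∧ (0 ≤ᵇ c))

peakGuard⇒height : ∀ h a b c → T (peakGuard h a b c) → suc h ≤ b
peakGuard⇒height h a b c g =
  ≤ᵇ⇒≤ (suc h) b (proj₁ (Equivalence.to (T-∧ {suc h ≤ᵇ b}) (proj₂ (Equivalence.to (T-∧ {1 ≤ᵇ a}) g))))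

isPath-ud : ∀ h a b c w →
  isPath h a b c (u ∷ d ∷ w) ≡ peakGuard h a b c ∧ isPath (suc h) (a ∸ 1) (b ∸ suc h) c (d ∷ w)
isPath-ud h a b c w
  rewrite valid-u h (d ∷ w) | +-≡ᵇ-split 1 (nbp (d ∷ w)) a | +-≡ᵇ-split (suc h) (sumpFrom (suc h) (d ∷ w)) b =
  solve 6 (λ v g₁ x g₂ y z → v :* ((g₁ :* x) :* ((g₂ :* y) :* z)) := (g₁ :* (g₂ :* con true)) :* (v :* (x :* (y :* z))))
        refl (valid h w) (1 ≤ᵇ a) (nbp (d ∷ w) ≡ᵇ a ∸ 1) (suc h ≤ᵇ b)
        (sumpFrom (suc h) (d ∷ w) ≡ᵇ b ∸ suc h) (sumvFrom (suc h) (d ∷ w) ≡ᵇ c)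
  where open ∨-∧-Solver

isPath-du : ∀ h a b c w → isPath (suc h) a b c (d ∷ u ∷ w) ≡ (h ≤ᵇ c) ∧ isPath h a b (c ∸ h) (u ∷ w)
isPath-du h a b c w rewrite +-≡ᵇ-split h (sumvFrom h (u ∷ w)) c =
  solve 5 (λ v x y g z → v :* (x :* (y :* (g :* z))) := g :* (v :* (x :* (y :* z))))
        refl (valid h (u ∷ w)) (nbp (u ∷ w) ≡ᵇ a) (sumpFrom h (u ∷ w) ≡ᵇ b) (h ≤ᵇ c) (sumvFrom h (u ∷ w) ≡ᵇ c ∸ h)
  where open ∨-∧-Solver

upPaths downPaths : ℕ → ℕ → ℕ → ℕ → ℕ → ℕ
upPaths   m h a b c = countBool (λ w → isPath h a b c (u ∷ w)) (words m)
downPaths m h a b c = countBool (λ w → isPath h a b c (d ∷ w)) (words m)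

upPaths-zero : ∀ h a b c → upPaths 0 h a b c ≡ 0
upPaths-zero zero    a b c = refl
upPaths-zero (suc h) a b c = refl

downPaths-at-axis : ∀ m a b c → downPaths m 0 a b c ≡ 0
downPaths-at-axis m a b c = countBool-false (words m)

upPaths-suc : ∀ m h a b c → upPaths (suc m) h a b c
  ≡ upPaths m (suc h) a b c + (if peakGuard h a b c then downPaths m (suc h) (a ∸ 1) (b ∸ suc h) c else 0)
upPaths-suc m h a b c = begin
    upPaths (suc m) h a b c
  ≡⟨ countBool-words-suc (λ w → isPath h a b c (u ∷ w)) m ⟩
    countBool (λ w → isPath h a b c (u ∷ u ∷ w)) (words m) + countBool (λ w → isPath h a b c (u ∷ d ∷ w)) (words m)
  ≡⟨ cong₂ _+_ (countBool-cong (isPath-uu h a b c) (words m))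
               (trans (countBool-cong (isPath-ud h a b c) (words m))
                      (countBool-guard (peakGuard h a b c) _ (words m))) ⟩
    upPaths m (suc h) a b c + (if peakGuard h a b c then downPaths m (suc h) (a ∸ 1) (b ∸ suc h) c else 0)
  ∎
  where open ≡-Reasoning

downPaths-suc : ∀ m h a b c → downPaths (suc m) (suc h) a b c
  ≡ (if h ≤ᵇ c then upPaths m h a b (c ∸ h) else 0) + downPaths m h a b c
downPaths-suc m h a b c =
  trans (countBool-words-suc (λ w → isPath (suc h) a b c (d ∷ w)) m)
        (cong (_+ downPaths m h a b c)
              (trans (countBool-cong (isPath-du h a b c) (words m)) (countBool-guard (h ≤ᵇ c) _ (words m))))

first-peak-budget : ∀ {h b m} → suc h ≤ b → b + b ≤ suc m + h → suc h + ((b ∸ suc h) + (b ∸ suc h)) ≤ m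
first-peak-budget {h} {b} {m} h<b le =
  ≤-pred (+-cancelʳ-≤ h _ _ (subst (_≤ suc m + h) (regroup h (b ∸ suc h))
                               (subst (λ b → b + b ≤ suc m + h) (sym (m+[n∸m]≡n h<b)) le)))
  where
  regroup : ∀ h e → (suc h + e) + (suc h + e) ≡ suc (suc h + (e + e)) + h
  regroup = solve-∀

-- The peak heights of a path u ∷ w from height h sum to at least h plus its number of up steps.
mutual
  upPaths-too-long : ∀ m h a b c → b + b ≤ m + h → upPaths m h a b c ≡ 0
  upPaths-too-long zero    h a b c _  = upPaths-zero h a b c
  upPaths-too-long (suc m) h a b c le rewrite upPaths-suc m h a b c =
    cong₂ _+_ (upPaths-too-long m (suc h) a b c (≤-trans le (≤-reflexive (sym (+-suc m h)))))
              (if-collapse (peakGuard h a b c) λ g →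
                 downPaths-too-long m (suc h) (a ∸ 1) (b ∸ suc h) c (first-peak-budget (peakGuard⇒height h a b c g) le))

  downPaths-too-long : ∀ m h a b c → h + (b + b) ≤ m → downPaths m h a b c ≡ 0
  downPaths-too-long m       zero    a b c _         = downPaths-at-axis m a b c
  downPaths-too-long (suc m) (suc h) a b c (s≤s le) rewrite downPaths-suc m h a b c =
    cong₂ _+_ (if-collapse (h ≤ᵇ c) λ _ →
                 upPaths-too-long m h a b (c ∸ h) (≤-trans (m≤n+m _ h) (≤-trans le (m≤m+n m h))))
              (downPaths-too-long m h a b c le)

mutual
  upPaths-parity : ∀ m h a b c → even m ≡ even h → upPaths m h a b c ≡ 0
  upPaths-parity zero    h a b c _ = upPaths-zero h a b c
  upPaths-parity (suc m) h a b c p rewrite upPaths-suc m h a b c =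
    cong₂ _+_ (upPaths-parity m (suc h) a b c p′)
              (if-collapse (peakGuard h a b c) λ _ → downPaths-parity m (suc h) (a ∸ 1) (b ∸ suc h) c p′)
    where
    p′ : even m ≡ not (even h)
    p′ = not-injective (trans p (sym (not-involutive (even h))))

  downPaths-parity : ∀ m h a b c → even m ≡ even h → downPaths m h a b c ≡ 0
  downPaths-parity m       zero          a b c _ = downPaths-at-axis m a b c
  downPaths-parity zero    (suc zero)    a b c ()
  downPaths-parity zero    (suc (suc h)) a b c _ = refl
  downPaths-parity (suc m) (suc h)       a b c p rewrite downPaths-suc m h a b c =
    cong₂ _+_ (if-collapse (h ≤ᵇ c) λ _ → upPaths-parity m h a b (c ∸ h) (not-injective p))
              (downPaths-parity m h a b c (not-injective p))

upPaths-low-peaks : ∀ m h a b c → b ≤ h → upPaths m h a b c ≡ 0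
upPaths-low-peaks zero    h a b c _   = upPaths-zero h a b c
upPaths-low-peaks (suc m) h a b c b≤h rewrite upPaths-suc m h a b c =
  cong₂ _+_ (upPaths-low-peaks m (suc h) a b c (m≤n⇒m≤1+n b≤h))
            (if-collapse (peakGuard h a b c) λ g → ⊥-elim (<⇒≱ (peakGuard⇒height h a b c g) b≤h))

-- A first step d from height 1 changes no statistic: the valley it may create is at height 0.
dyck-as-tail : ∀ a b c w → valid 0 w ∧ hasStats a b c w ≡ isPath 1 a b c (d ∷ w)
dyck-as-tail a b c []      = refl
dyck-as-tail a b c (u ∷ w) = refl
dyck-as-tail a b c (d ∷ w) = refl

countAt≡downPaths : ∀ n a b c → countAt n a b c ≡ downPaths (n + n) 1 a b c
countAt≡downPaths n a b c =
  trans (countBool-filter (valid 0) (hasStats a b c) (words (n + n))) (countBool-cong (dyck-as-tail a b c) (words (n + n)))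

countUpTo≡∑ : ∀ K a b c → ∑[ n < K ] downPaths (suc n + suc n) 1 a b c ≡ countUpTo K a b c
countUpTo≡∑ zero    a b c = refl
countUpTo≡∑ (suc K) a b c =
  trans (cong₂ _+_ (countUpTo≡∑ K a b c) (sym (countAt≡downPaths (suc K) a b c))) (+-comm (countUpTo K a b c) _)

-- Series and their products with polynomials

infix 4 _≗ˢ_
_≗ˢ_ : Series → Series → Set
S ≗ˢ R = ∀ a b c → S a b c ≡ R a b c

infixl 6 _+ˢ_ _-ˢ_
_+ˢ_ _-ˢ_ : Series → Series → Series
(S +ˢ R) a b c = S a b c ℤ.+ R a b c
(S -ˢ R) a b c = S a b c ℤ.- R a b c

-ˢ_ : Series → Series
(-ˢ S) a b c = ℤ.- S a b c

≗ˢ-subtract : ∀ {S R T} → S ≗ˢ R +ˢ T → R ≗ˢ S -ˢ T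
≗ˢ-subtract {S} {R} {T} S≗R+T a b c = begin
    R a b c
  ≡⟨ cancel (R a b c) (T a b c) ⟨
    R a b c ℤ.+ T a b c ℤ.- T a b c
  ≡⟨ cong (ℤ._- T a b c) (S≗R+T a b c) ⟨
    S a b c ℤ.- T a b c
  ∎
  where
  open ≡-Reasoning
  cancel : ∀ x y → x ℤ.+ y ℤ.- y ≡ x
  cancel = ℤ-Solver.solve-∀

one : Series
one a b c = if (0 ≡ᵇ a) ∧ ((0 ≡ᵇ b) ∧ (0 ≡ᵇ c)) then 1ℤ else 0ℤ

Term : Set
Term = ℤ × ℕ × ℕ × ℕ

-- mulCoeff S (t ∷ P) reduces to term S t +ˢ mulCoeff S P.
term : Series → Term → Series
term S (k , i , j , l) a b c = if (i ≤ᵇ a) ∧ ((j ≤ᵇ b) ∧ (l ≤ᵇ c)) then k ℤ.* S (a ∸ i) (b ∸ j) (c ∸ l) else 0ℤ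

_*ᵗ_ : Term → Term → Term
(k , i , j , l) *ᵗ (k′ , i′ , j′ , l′) = (k ℤ.* k′ , i + i′ , j + j′ , l + l′)

if-∧-* : ∀ X Y (x y : ℤ) → (if X ∧ Y then x ℤ.* y else 0ℤ) ≡ (if X then x ℤ.* (if Y then y else 0ℤ) else 0ℤ)
if-∧-* true  true  x y = refl
if-∧-* true  false x y = sym (*-zeroʳ x)
if-∧-* false Y     x y = refl

term-*ᵗ : ∀ S t t′ → term S (t *ᵗ t′) ≗ˢ term (term S t) t′
term-*ᵗ S (k , i , j , l) (k′ , i′ , j′ , l′) a b c
  rewrite +-comm i i′ | +-comm j j′ | +-comm l l′
        | +-≤ᵇ-split i′ i a | +-≤ᵇ-split j′ j b | +-≤ᵇ-split l′ l c
        | sym (∸-+-assoc a i′ i) | sym (∸-+-assoc b j′ j) | sym (∸-+-assoc c l′ l)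
        | ∧-interchange₃ (i′ ≤ᵇ a) (i ≤ᵇ a ∸ i′) (j′ ≤ᵇ b) (j ≤ᵇ b ∸ j′) (l′ ≤ᵇ c) (l ≤ᵇ c ∸ l′)
        | ℤP.*-comm k k′ | ℤP.*-assoc k′ k (S (a ∸ i′ ∸ i) (b ∸ j′ ∸ j) (c ∸ l′ ∸ l))
  = if-∧-* ((i′ ≤ᵇ a) ∧ ((j′ ≤ᵇ b) ∧ (l′ ≤ᵇ c))) ((i ≤ᵇ a ∸ i′) ∧ ((j ≤ᵇ b ∸ j′) ∧ (l ≤ᵇ c ∸ l′))) k′ _

mulCoeff-cong : ∀ {S R} P → S ≗ˢ R → mulCoeff S P ≗ˢ mulCoeff R P
mulCoeff-cong []                    S≗R a b c = refl
mulCoeff-cong ((k , i , j , l) ∷ P) S≗R a b c =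
  cong₂ ℤ._+_ (cong (λ s → if (i ≤ᵇ a) ∧ ((j ≤ᵇ b) ∧ (l ≤ᵇ c)) then k ℤ.* s else 0ℤ) (S≗R (a ∸ i) (b ∸ j) (c ∸ l)))
              (mulCoeff-cong P S≗R a b c)

mulCoeff-⊕ : ∀ S P Q → mulCoeff S (P ⊕ Q) ≗ˢ mulCoeff S P +ˢ mulCoeff S Q
mulCoeff-⊕ S []      Q a b c = sym (+-identityˡ _)
mulCoeff-⊕ S (t ∷ P) Q a b c =
  trans (cong (λ x → term S t a b c ℤ.+ x) (mulCoeff-⊕ S P Q a b c)) (sym (ℤP.+-assoc (term S t a b c) _ _))

mulCoeff-⊖ : ∀ S P → mulCoeff S (⊖ P) ≗ˢ -ˢ mulCoeff S P
mulCoeff-⊖ S []                    a b c = refl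
mulCoeff-⊖ S ((k , i , j , l) ∷ P) a b c =
  trans (cong₂ ℤ._+_ negated-term (mulCoeff-⊖ S P a b c)) (sym (neg-distrib-+ (term S (k , i , j , l) a b c) _))
  where
  negated-term : term S (ℤ.- k , i , j , l) a b c ≡ ℤ.- term S (k , i , j , l) a b c
  negated-term with (i ≤ᵇ a) ∧ ((j ≤ᵇ b) ∧ (l ≤ᵇ c))
  ... | true  = sym (neg-distribˡ-* k _)
  ... | false = refl

mulCoeff-+ˢ : ∀ S R P → mulCoeff (S +ˢ R) P ≗ˢ mulCoeff S P +ˢ mulCoeff R P
mulCoeff-+ˢ S R []                    a b c = refl
mulCoeff-+ˢ S R ((k , i , j , l) ∷ P) a b c =
  trans (cong₂ ℤ._+_ summed-term (mulCoeff-+ˢ S R P a b c))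
        (interchange (term S (k , i , j , l) a b c) (term R (k , i , j , l) a b c) (mulCoeff S P a b c) _)
  where
  summed-term : term (S +ˢ R) (k , i , j , l) a b c ≡ term S (k , i , j , l) a b c ℤ.+ term R (k , i , j , l) a b c
  summed-term with (i ≤ᵇ a) ∧ ((j ≤ᵇ b) ∧ (l ≤ᵇ c))
  ... | true  = *-distribˡ-+ k _ _
  ... | false = refl
  interchange : ∀ (w x y z : ℤ) → (w ℤ.+ x) ℤ.+ (y ℤ.+ z) ≡ (w ℤ.+ y) ℤ.+ (x ℤ.+ z)
  interchange = ℤ-Solver.solve-∀

mulCoeff-negˢ : ∀ S P → mulCoeff (-ˢ S) P ≗ˢ -ˢ mulCoeff S P
mulCoeff-negˢ S []                    a b c = refl
mulCoeff-negˢ S ((k , i , j , l) ∷ P) a b c =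
  trans (cong₂ ℤ._+_ negated-term (mulCoeff-negˢ S P a b c)) (sym (neg-distrib-+ (term S (k , i , j , l) a b c) _))
  where
  negated-term : term (-ˢ S) (k , i , j , l) a b c ≡ ℤ.- term S (k , i , j , l) a b c
  negated-term with (i ≤ᵇ a) ∧ ((j ≤ᵇ b) ∧ (l ≤ᵇ c))
  ... | true  = sym (neg-distribʳ-* k _)
  ... | false = refl

mulCoeff--ˢ : ∀ S R P → mulCoeff (S -ˢ R) P ≗ˢ mulCoeff S P -ˢ mulCoeff R P
mulCoeff--ˢ S R P a b c = trans (mulCoeff-+ˢ S (-ˢ R) P a b c) (cong (λ x → mulCoeff S P a b c ℤ.+ x) (mulCoeff-negˢ R P a b c))

mulCoeff-⊗ : ∀ S P Q → mulCoeff S (P ⊗ Q) ≗ˢ mulCoeff (mulCoeff S P) Q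
mulCoeff-⊗ S []      Q a b c = sym (mulCoeff-zero Q)
  where
  mulCoeff-zero : ∀ Q → mulCoeff (λ _ _ _ → 0ℤ) Q a b c ≡ 0ℤ
  mulCoeff-zero []                    = refl
  mulCoeff-zero ((k , i , j , l) ∷ Q) =
    cong₂ ℤ._+_ (if-collapse ((i ≤ᵇ a) ∧ ((j ≤ᵇ b) ∧ (l ≤ᵇ c))) (λ _ → *-zeroʳ k)) (mulCoeff-zero Q)
mulCoeff-⊗ S (t ∷ P) Q a b c = begin
    mulCoeff S (map (t *ᵗ_) Q ++ (P ⊗ Q)) a b c
  ≡⟨ mulCoeff-⊕ S (map (t *ᵗ_) Q) (P ⊗ Q) a b c ⟩
    mulCoeff S (map (t *ᵗ_) Q) a b c ℤ.+ mulCoeff S (P ⊗ Q) a b c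
  ≡⟨ cong₂ ℤ._+_ (mulCoeff-map Q a b c) (mulCoeff-⊗ S P Q a b c) ⟩
    mulCoeff (term S t) Q a b c ℤ.+ mulCoeff (mulCoeff S P) Q a b c
  ≡⟨ mulCoeff-+ˢ (term S t) (mulCoeff S P) Q a b c ⟨
    mulCoeff (term S t +ˢ mulCoeff S P) Q a b c
  ∎
  where
  open ≡-Reasoning
  mulCoeff-map : ∀ Q → mulCoeff S (map (t *ᵗ_) Q) ≗ˢ mulCoeff (term S t) Q
  mulCoeff-map []       a b c = refl
  mulCoeff-map (t′ ∷ Q) a b c = cong₂ ℤ._+_ (term-*ᵗ S t t′ a b c) (mulCoeff-map Q a b c)

mulCoeff-monomial : ∀ S i j l a b c →
  mulCoeff S (mono 1ℤ i j l) a b c ≡ (if (i ≤ᵇ a) ∧ ((j ≤ᵇ b) ∧ (l ≤ᵇ c)) then S (a ∸ i) (b ∸ j) (c ∸ l) else 0ℤ)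
mulCoeff-monomial S i j l a b c with (i ≤ᵇ a) ∧ ((j ≤ᵇ b) ∧ (l ≤ᵇ c))
... | true  = trans (ℤP.+-identityʳ _) (*-identityˡ _)
... | false = refl

≡ᵇ-split : ∀ m o → (m ≡ᵇ o) ≡ (m ≤ᵇ o) ∧ (0 ≡ᵇ o ∸ m)
≡ᵇ-split m o = subst (λ n → (n ≡ᵇ o) ≡ (m ≤ᵇ o) ∧ (0 ≡ᵇ o ∸ m)) (+-identityʳ m) (+-≡ᵇ-split m 0 o)

mulCoeff-one : ∀ P → mulCoeff one P ≗ˢ polyCoeff P
mulCoeff-one []                    a b c = refl
mulCoeff-one ((k , i , j , l) ∷ P) a b c = cong₂ ℤ._+_ head (mulCoeff-one P a b c)
  where
  head : term one (k , i , j , l) a b c ≡ (if (i ≡ᵇ a) ∧ ((j ≡ᵇ b) ∧ (l ≡ᵇ c)) then k else 0ℤ)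
  head rewrite ≡ᵇ-split i a | ≡ᵇ-split j b | ≡ᵇ-split l c
             | ∧-interchange₃ (i ≤ᵇ a) (0 ≡ᵇ a ∸ i) (j ≤ᵇ b) (0 ≡ᵇ b ∸ j) (l ≤ᵇ c) (0 ≡ᵇ c ∸ l) =
    trans (sym (if-∧-* X Y k 1ℤ)) (cong (λ z → if X ∧ Y then z else 0ℤ) (*-identityʳ k))
    where
    X Y : Bool
    X = (i ≤ᵇ a) ∧ ((j ≤ᵇ b) ∧ (l ≤ᵇ c))
    Y = (0 ≡ᵇ a ∸ i) ∧ ((0 ≡ᵇ b ∸ j) ∧ (0 ≡ᵇ c ∸ l))

-- The generating functions of path tails

-- upSum h and downSum h count the paths from height h that start with u, resp. d. The sums are
-- complete by upPaths-too-long and downPaths-too-long.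
upSum downSum : ℕ → ℕ → ℕ → ℕ → ℕ
upSum   h a b c = ∑[ m < suc (b + b) ] upPaths m h a b c
downSum h a b c = ∑[ m < h + (b + b) ] downPaths m h a b c

upSum-step : ∀ h a b c →
  upSum h a b c ≡ upSum (suc h) a b c + (if peakGuard h a b c then downSum (suc h) (a ∸ 1) (b ∸ suc h) c else 0)
upSum-step h a b c = begin
    ∑[ m < suc (b + b) ] upPaths m h a b c
  ≡⟨ ∑-head (b + b) (λ m → upPaths m h a b c) ⟩
    upPaths 0 h a b c + ∑[ m < b + b ] upPaths (suc m) h a b c
  ≡⟨ cong₂ _+_ (upPaths-zero h a b c) (∑-cong (b + b) (λ m → upPaths-suc m h a b c)) ⟩
    ∑[ m < b + b ] (upPaths m (suc h) a b c + (if g then down m else 0))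
  ≡⟨ ∑-+ (b + b) (λ m → upPaths m (suc h) a b c) (λ m → if g then down m else 0) ⟩
    ∑[ m < b + b ] upPaths m (suc h) a b c + ∑[ m < b + b ] (if g then down m else 0)
  ≡⟨ cong₂ _+_ last-vanishes (∑-if (b + b) g down) ⟩
    upSum (suc h) a b c + (if g then ∑[ m < b + b ] down m else 0)
  ≡⟨ cong (λ x → upSum (suc h) a b c + x) (if-then-cong g λ g′ →
       ∑-stable (b + b) (suc h + (e + e)) down (λ m → downPaths-too-long m (suc h) (a ∸ 1) e c)
                (first-peak-budget (peakGuard⇒height h a b c g′) (≤-trans (n≤1+n _) (m≤m+n _ h))) ≤-refl) ⟩
    upSum (suc h) a b c + (if g then downSum (suc h) (a ∸ 1) e c else 0)
  ∎
  where
  open ≡-Reasoning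
  g : Bool
  g = peakGuard h a b c
  e : ℕ
  e = b ∸ suc h
  down : ℕ → ℕ
  down m = downPaths m (suc h) (a ∸ 1) e c
  last-vanishes : ∑[ m < b + b ] upPaths m (suc h) a b c ≡ upSum (suc h) a b c
  last-vanishes = sym (trans (cong (λ x → ∑[ m < b + b ] upPaths m (suc h) a b c + x)
                                   (upPaths-too-long (b + b) (suc h) a b c (m≤m+n _ _)))
                             (+-identityʳ _))

downSum-step : ∀ h a b c →
  downSum (suc h) a b c ≡ (if h ≤ᵇ c then upSum h a b (c ∸ h) else 0) + (downPaths 0 (suc h) a b c + downSum h a b c)
downSum-step h a b c = begin
    ∑[ m < suc h + (b + b) ] downPaths m (suc h) a b c
  ≡⟨ ∑-head (h + (b + b)) (λ m → downPaths m (suc h) a b c) ⟩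
    down₀ + ∑[ m < h + (b + b) ] downPaths (suc m) (suc h) a b c
  ≡⟨ cong (λ x → down₀ + x) (∑-cong (h + (b + b)) (λ m → downPaths-suc m h a b c)) ⟩
    down₀ + ∑[ m < h + (b + b) ] ((if h ≤ᵇ c then up m else 0) + downPaths m h a b c)
  ≡⟨ cong (λ x → down₀ + x) (∑-+ (h + (b + b)) (λ m → if h ≤ᵇ c then up m else 0) (λ m → downPaths m h a b c)) ⟩
    down₀ + (∑[ m < h + (b + b) ] (if h ≤ᵇ c then up m else 0) + downSum h a b c)
  ≡⟨ cong (λ x → down₀ + (x + downSum h a b c)) (∑-if (h + (b + b)) (h ≤ᵇ c) up) ⟩
    down₀ + ((if h ≤ᵇ c then ∑[ m < h + (b + b) ] up m else 0) + downSum h a b c)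
  ≡⟨ cong (λ x → down₀ + ((if h ≤ᵇ c then x else 0) + downSum h a b c))
          (∑-stable (h + (b + b)) (suc (b + b)) up (λ m le → upPaths-too-long m h a b (c ∸ h) (≤-trans le (m≤m+n m h)))
                    (m≤n+m _ h) (n≤1+n _)) ⟩
    down₀ + ((if h ≤ᵇ c then upSum h a b (c ∸ h) else 0) + downSum h a b c)
  ≡⟨ x+[y+z]≡y+[x+z] down₀ (if h ≤ᵇ c then upSum h a b (c ∸ h) else 0) (downSum h a b c) ⟩
    (if h ≤ᵇ c then upSum h a b (c ∸ h) else 0) + (down₀ + downSum h a b c)
  ∎
  where
  open ≡-Reasoning
  down₀ : ℕ
  down₀ = downPaths 0 (suc h) a b c
  up : ℕ → ℕ
  up m = upPaths m h a b (c ∸ h)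
  x+[y+z]≡y+[x+z] : ∀ x y z → x + (y + z) ≡ y + (x + z)
  x+[y+z]≡y+[x+z] = solve-∀

-- U h and D h count the paths from height h that start, resp. do not start, with u; for D 0 that
-- is the empty path alone.
U : ℕ → Series
U h a b c = + upSum h a b c

D : ℕ → Series
D zero          = one
D (suc h) a b c = + downSum (suc h) a b c

D-as-sum : ∀ h a b c → + (downPaths 0 (suc h) a b c + downSum h a b c) ≡ D h a b c
D-as-sum zero a b c rewrite ∑-zero (b + b) (λ m → downPaths-at-axis m a b c) with (0 ≡ᵇ a) ∧ ((0 ≡ᵇ b) ∧ (0 ≡ᵇ c))
... | true  = refl
... | false = refl
D-as-sum (suc h) a b c = refl

U-transfer : ∀ h → U h ≗ˢ U (suc h) +ˢ mulCoeff (D (suc h)) (mono 1ℤ 1 (suc h) 0)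
U-transfer h a b c = begin
    + upSum h a b c
  ≡⟨ cong +_ (upSum-step h a b c) ⟩
    + (upSum (suc h) a b c + (if g then downSum (suc h) (a ∸ 1) (b ∸ suc h) c else 0))
  ≡⟨ pos-+ (upSum (suc h) a b c) _ ⟩
    U (suc h) a b c ℤ.+ + (if g then downSum (suc h) (a ∸ 1) (b ∸ suc h) c else 0)
  ≡⟨ cong (λ x → U (suc h) a b c ℤ.+ x) (if-float +_ g) ⟩
    U (suc h) a b c ℤ.+ (if g then D (suc h) (a ∸ 1) (b ∸ suc h) c else 0ℤ)
  ≡⟨ cong (λ x → U (suc h) a b c ℤ.+ x) (mulCoeff-monomial (D (suc h)) 1 (suc h) 0 a b c) ⟨
    U (suc h) a b c ℤ.+ mulCoeff (D (suc h)) (mono 1ℤ 1 (suc h) 0) a b c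
  ∎
  where
  open ≡-Reasoning
  g : Bool
  g = peakGuard h a b c

D-transfer : ∀ h → D (suc h) ≗ˢ mulCoeff (U h) (mono 1ℤ 0 0 h) +ˢ D h
D-transfer h a b c = begin
    + downSum (suc h) a b c
  ≡⟨ cong +_ (downSum-step h a b c) ⟩
    + (valleys + (downPaths 0 (suc h) a b c + downSum h a b c))
  ≡⟨ pos-+ valleys _ ⟩
    + valleys ℤ.+ + (downPaths 0 (suc h) a b c + downSum h a b c)
  ≡⟨ cong₂ ℤ._+_ (trans (if-float +_ (h ≤ᵇ c)) (sym (mulCoeff-monomial (U h) 0 0 h a b c))) (D-as-sum h a b c) ⟩
    mulCoeff (U h) (mono 1ℤ 0 0 h) a b c ℤ.+ D h a b c
  ∎
  where
  open ≡-Reasoning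
  valleys : ℕ
  valleys = if h ≤ᵇ c then upSum h a b (c ∸ h) else 0

-- The three-term recurrence and its convergents

vPoly : Poly
vPoly = mono 1ℤ 0 0 1

partialDenominator : ℕ → Poly
partialDenominator j = (mono 1ℤ 0 0 0 ⊕ vPoly) ⊕ (⊖ pq^v^ j)

mulCoeff-partialDenominator : ∀ S j →
  mulCoeff S (partialDenominator j) ≗ˢ (S +ˢ mulCoeff S vPoly) -ˢ mulCoeff S (pq^v^ j)
mulCoeff-partialDenominator S j a b c =
  trans (mulCoeff-⊕ S (mono 1ℤ 0 0 0 ⊕ vPoly) (⊖ pq^v^ j) a b c)
        (cong₂ ℤ._+_ (trans (mulCoeff-⊕ S (mono 1ℤ 0 0 0) vPoly a b c)
                            (cong (ℤ._+ mulCoeff S vPoly a b c) (mulCoeff-monomial S 0 0 0 a b c)))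
                     (mulCoeff-⊖ S (pq^v^ j) a b c))

D-recurrence : ∀ h → D (suc (suc h)) ≗ˢ mulCoeff (D (suc h)) (partialDenominator (suc h)) -ˢ mulCoeff (D h) vPoly
D-recurrence h a b c = begin
    D (suc (suc h)) a b c
  ≡⟨ D-transfer (suc h) a b c ⟩
    mulCoeff (U (suc h)) (mono 1ℤ 0 0 (suc h)) a b c ℤ.+ A a b c
  ≡⟨ cong (ℤ._+ A a b c) valley-term ⟩
    ((Av ℤ.- Bv) ℤ.- Apqv) ℤ.+ A a b c
  ≡⟨ regroup (A a b c) Av Bv Apqv ⟩
    (A a b c ℤ.+ Av) ℤ.- Apqv ℤ.- Bv
  ≡⟨ cong (ℤ._- Bv) (mulCoeff-partialDenominator A (suc h) a b c) ⟨
    mulCoeff A (partialDenominator (suc h)) a b c ℤ.- Bv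
  ∎
  where
  open ≡-Reasoning
  A B : Series
  A = D (suc h)
  B = D h
  pq : Poly
  pq = mono 1ℤ 1 (suc h) 0
  Av Bv Apqv : ℤ
  Av   = mulCoeff A vPoly a b c
  Bv   = mulCoeff B vPoly a b c
  Apqv = mulCoeff A (pq^v^ (suc h)) a b c
  regroup : ∀ x y z w → ((y ℤ.- z) ℤ.- w) ℤ.+ x ≡ (x ℤ.+ y) ℤ.- w ℤ.- z
  regroup = ℤ-Solver.solve-∀
  valley-term : mulCoeff (U (suc h)) (mono 1ℤ 0 0 (suc h)) a b c ≡ (Av ℤ.- Bv) ℤ.- Apqv
  valley-term = begin
      mulCoeff (U (suc h)) (mono 1ℤ 0 0 (suc h)) a b c
    ≡⟨ mulCoeff-cong (mono 1ℤ 0 0 (suc h)) (≗ˢ-subtract {U h} {U (suc h)} {mulCoeff A pq} (U-transfer h)) a b c ⟩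
      mulCoeff (U h -ˢ mulCoeff A pq) (mono 1ℤ 0 0 (suc h)) a b c
    ≡⟨ mulCoeff--ˢ (U h) (mulCoeff A pq) (mono 1ℤ 0 0 (suc h)) a b c ⟩
      mulCoeff (U h) (mono 1ℤ 0 0 (suc h)) a b c ℤ.- mulCoeff (mulCoeff A pq) (mono 1ℤ 0 0 (suc h)) a b c
    ≡⟨ cong₂ ℤ._-_ (trans (cong (λ P → mulCoeff (U h) P a b c) (cong (λ n → (1ℤ , 0 , 0 , n) ∷ []) (+-comm 1 h)))
                          (mulCoeff-⊗ (U h) (mono 1ℤ 0 0 h) vPoly a b c))
                   (trans (sym (mulCoeff-⊗ A pq (mono 1ℤ 0 0 (suc h)) a b c))
                          (cong (λ n → mulCoeff A ((1ℤ , 1 , n , suc h) ∷ []) a b c) (+-identityʳ (suc h)))) ⟩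
      mulCoeff (mulCoeff (U h) (mono 1ℤ 0 0 h)) vPoly a b c ℤ.- Apqv
    ≡⟨ cong (ℤ._- Apqv) (mulCoeff-cong vPoly (≗ˢ-subtract {A} {mulCoeff (U h) (mono 1ℤ 0 0 h)} {B} (D-transfer h)) a b c) ⟩
      mulCoeff (A -ˢ B) vPoly a b c ℤ.- Apqv
    ≡⟨ cong (ℤ._- Apqv) (mulCoeff--ˢ A B vPoly a b c) ⟩
      (Av ℤ.- Bv) ℤ.- Apqv
    ∎

module Telescoping
  (X : ℕ → Series)
  (recurrence : ∀ h → X (suc (suc h)) ≗ˢ mulCoeff (X (suc h)) (partialDenominator (suc h)) -ˢ mulCoeff (X h) vPoly)
  where

  telescope : ∀ i k → mulCoeff (X (suc i)) (proj₂ (cf (suc i) k)) -ˢ mulCoeff (X i) (proj₁ (cf (suc i) k))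
                      ≗ˢ X (suc (i + k)) -ˢ X (i + k)
  telescope i zero a b c rewrite +-identityʳ i =
    cong₂ ℤ._-_ (mulCoeff-monomial (X (suc i)) 0 0 0 a b c) (mulCoeff-monomial (X i) 0 0 0 a b c)
  telescope i (suc k) a b c = begin
      mulCoeff (X (suc i)) ((partialDenominator (suc i) ⊗ Q) ⊕ (⊖ P)) a b c ℤ.- mulCoeff (X i) (vPoly ⊗ Q) a b c
    ≡⟨ cong₂ ℤ._-_ (trans (mulCoeff-⊕ (X (suc i)) (partialDenominator (suc i) ⊗ Q) (⊖ P) a b c)
                          (cong₂ ℤ._+_ (mulCoeff-⊗ (X (suc i)) (partialDenominator (suc i)) Q a b c)
                                       (mulCoeff-⊖ (X (suc i)) P a b c)))
                   (mulCoeff-⊗ (X i) vPoly Q a b c) ⟩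
      (XW ℤ.- XP) ℤ.- Xv
    ≡⟨ swap XW XP Xv ⟩
      (XW ℤ.- Xv) ℤ.- XP
    ≡⟨ cong (ℤ._- XP) (mulCoeff--ˢ (mulCoeff (X (suc i)) (partialDenominator (suc i))) (mulCoeff (X i) vPoly) Q a b c) ⟨
      mulCoeff (mulCoeff (X (suc i)) (partialDenominator (suc i)) -ˢ mulCoeff (X i) vPoly) Q a b c ℤ.- XP
    ≡⟨ cong (ℤ._- XP) (mulCoeff-cong Q (recurrence i) a b c) ⟨
      mulCoeff (X (suc (suc i))) Q a b c ℤ.- XP
    ≡⟨ telescope (suc i) k a b c ⟩
      X (suc (suc i + k)) a b c ℤ.- X (suc i + k) a b c
    ≡⟨ cong (λ n → X (suc n) a b c ℤ.- X n a b c) (+-suc i k) ⟨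
      X (suc (i + suc k)) a b c ℤ.- X (i + suc k) a b c
    ∎
    where
    open ≡-Reasoning
    P Q : Poly
    P = proj₁ (cf (suc (suc i)) k)
    Q = proj₂ (cf (suc (suc i)) k)
    XW XP Xv : ℤ
    XW = mulCoeff (mulCoeff (X (suc i)) (partialDenominator (suc i))) Q a b c
    XP = mulCoeff (X (suc i)) P a b c
    Xv = mulCoeff (mulCoeff (X i) vPoly) Q a b c
    swap : ∀ x y z → (x ℤ.- y) ℤ.- z ≡ (x ℤ.- z) ℤ.- y
    swap = ℤ-Solver.solve-∀

onePlusA-as-count : ∀ a b c → + (downPaths 0 1 a b c + countUpTo b a b c) ≡ onePlusA a b c
onePlusA-as-count zero    zero    zero    = refl
onePlusA-as-count zero    zero    (suc c) = refl
onePlusA-as-count zero    (suc b) c       = refl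
onePlusA-as-count (suc a) b       c       = refl

D-one : D 1 ≗ˢ onePlusA
D-one a b c = begin
    + ∑[ m < suc (b + b) ] downPaths m 1 a b c
  ≡⟨ cong +_ (∑-even b (λ m → downPaths m 1 a b c) odd-lengths-vanish) ⟩
    + ∑[ n < suc b ] downPaths (n + n) 1 a b c
  ≡⟨ cong +_ (∑-head b (λ n → downPaths (n + n) 1 a b c)) ⟩
    + (downPaths 0 1 a b c + ∑[ n < b ] downPaths (suc n + suc n) 1 a b c)
  ≡⟨ cong (λ x → + (downPaths 0 1 a b c + x)) (countUpTo≡∑ b a b c) ⟩
    + (downPaths 0 1 a b c + countUpTo b a b c)
  ≡⟨ onePlusA-as-count a b c ⟩
    onePlusA a b c
  ∎
  where
  open ≡-Reasoning
  odd-lengths-vanish : ∀ k → downPaths (suc (k + k)) 1 a b c ≡ 0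
  odd-lengths-vanish k = downPaths-parity (suc (k + k)) 1 a b c (cong not (even-double k))

D-stable : ∀ N a b c → b ≤ N → D (suc N) a b c ≡ D N a b c
D-stable N a b c b≤N = begin
    D (suc N) a b c
  ≡⟨ D-transfer N a b c ⟩
    mulCoeff (U N) (mono 1ℤ 0 0 N) a b c ℤ.+ D N a b c
  ≡⟨ cong (ℤ._+ D N a b c) (trans (mulCoeff-monomial (U N) 0 0 N a b c) (if-collapse (N ≤ᵇ c) λ _ → no-high-peaks)) ⟩
    0ℤ ℤ.+ D N a b c
  ≡⟨ +-identityˡ _ ⟩
    D N a b c
  ∎
  where
  open ≡-Reasoning
  no-high-peaks : U N a b (c ∸ N) ≡ 0ℤ
  no-high-peaks = cong +_ (∑-zero (suc (b + b)) λ m → upPaths-low-peaks m N a b (c ∸ N) b≤N)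

theorem3p1 : ((n a b c : ℕ) → b < n → countAt n a b c ≡ 0)
    × ((N a b c : ℕ) → b ≤ N → mulCoeff onePlusA (denCF N) a b c ≡ polyCoeff (numCF N) a b c)
theorem3p1 = short-paths , convergents
  where
  short-paths : (n a b c : ℕ) → b < n → countAt n a b c ≡ 0
  short-paths n a b c b<n =
    trans (countAt≡downPaths n a b c) (downPaths-too-long (n + n) 1 a b c (+-mono-< b<n b<n))
  convergents : (N a b c : ℕ) → b ≤ N → mulCoeff onePlusA (denCF N) a b c ≡ polyCoeff (numCF N) a b c
  convergents N a b c b≤N = begin
      mulCoeff onePlusA (denCF N) a b c
    ≡⟨ mulCoeff-cong (denCF N) D-one a b c ⟨
      mulCoeff (D 1) (denCF N) a b c
    ≡⟨ i-j≡0⇒i≡j _ _ (trans (Telescoping.telescope D D-recurrence 0 N a b c) (i≡j⇒i-j≡0 (D-stable N a b c b≤N))) ⟩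
      mulCoeff (D 0) (numCF N) a b c
    ≡⟨ mulCoeff-one (numCF N) a b c ⟩
      polyCoeff (numCF N) a b c
    ∎
    where open ≡-Reasoning
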